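{- Let $k$ be a positive integer and let $\phi$ be a permutation of $\mathfrak{R}=\mathbb{Z}_{2^k}[x]/\langle x^2+x+1\rangle$. Then $$\overrightarrow{C}_{(4^k:3)}=\bigoplus_{\alpha\in\mathfrak{R}}T_{4^k}(\alpha)=\bigoplus_{\alpha\in\mathfrak{R}}H_{4^k}(\alpha,\phi(\alpha)),$$ and $\bigoplus_{\alpha\in\mathfrak{R}}H_{4^k}(\alpha,\phi(\alpha))$ is a decomposition of $\overrightarrow{C}_{(4^k:3)}$.
   Context: $\overrightarrow{C}_{(4^k:3)}$ is the directed graph with three parts $G_0,G_1,G_2$, each of size $4^k$, with an arc from every vertex of $G_i$ to every vertex of $G_{i+1}$ (indices mod 3). The vertices of each part are labeled by the elements of the ring $\mathfrak{R}=\mathbb{Z}_{2^k}[x]/\langle x^2+x+1\rangle$ (elements $a+bx$, $a,b\in\mathbb{Z}_{2^k}$). For $\alpha\in\mathfrak{R}$ let $f_\alpha(y)=xy+\alpha$. $T_{4^k}(\alpha)$ is the spanning subgraph whose arcs go from each $y\in G_i$ to $f_\alpha(y)\in G_{i+1}$ for $i=0,1,2$ (indices mod 3). $H_{4^k}(\alpha,\beta)$ is the spanning subgraph whose arcs go from each $y$ in $G_0$ (resp. $G_1$) to $f_\alpha(y)$ in $G_1$ (resp. $G_2$), and from each $y$ in $G_2$ to $f_\beta(y)$ in $G_0$. $\bigoplus$ denotes arc-disjoint union; a decomposition is a partition of the arc set into spanning subgraphs. -}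

module Defs where

open import Data.Nat using (ℕ; zero; suc; _+_; _*_; _∸_; _^_; _%_; NonZero)
open import Data.Nat.Properties using (m^n≢0)
open import Data.Nat.DivMod using (m%n<n)
open import Data.Fin using (Fin; toℕ; fromℕ<) renaming (zero to f0; suc to fs)
open import Data.Product using (_×_; _,_; ∃!)
open import Relation.Binary.PropositionalEquality using (_≡_)
open import Function.Bundles using (_↔_; Inverse)

mod : ℕ → ℕ
mod k = 2 ^ k

mod-nonZero : (k : ℕ) → NonZero (mod k)
mod-nonZero k = m^n≢0 2 k

Zk : ℕ → Set
Zk k = Fin (mod k)

reduce : (k : ℕ) → ℕ → Zk k
reduce k m = fromℕ< (m%n<n m (mod k) {{mod-nonZero k}})

zadd : (k : ℕ) → Zk k → Zk k → Zk k
zadd k a b = reduce k (toℕ a + toℕ b)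

zmul : (k : ℕ) → Zk k → Zk k → Zk k
zmul k a b = reduce k (toℕ a * toℕ b)

-- additive inverse: -a = (2^k - 1) * a  (mod 2^k)
zneg : (k : ℕ) → Zk k → Zk k
zneg k a = reduce k ((mod k ∸ 1) * toℕ a)

-- The ring R = Z_{2^k}[x]/<x^2+x+1>; the pair (a , b) stands for a + b x.
R : ℕ → Set
R k = Zk k × Zk k

radd : (k : ℕ) → R k → R k → R k
radd k (a , b) (c , d) = zadd k a c , zadd k b d

-- (a + b x)(c + d x) = ac + (ad + bc) x + bd x^2, and x^2 = -x - 1,
-- so the product is (ac - bd) + (ad + bc - bd) x.
rmul : (k : ℕ) → R k → R k → R k
rmul k (a , b) (c , d) =
  zadd k (zmul k a c) (zneg k (zmul k b d)) ,
  zadd k (zadd k (zmul k a d) (zmul k b c)) (zneg k (zmul k b d))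

xR : (k : ℕ) → R k
xR k = reduce k 0 , reduce k 1

f : (k : ℕ) → R k → R k → R k
f k α y = radd k (rmul k (xR k) y) α

next : Fin 3 → Fin 3
next f0 = fs f0
next (fs f0) = fs (fs f0)
next (fs (fs f0)) = f0

-- Arcs of C→_(4^k:3): an arc is determined by its source part i, its source
-- vertex u ∈ G_i and its target vertex v ∈ G_{i+1}; every such triple is an arc.
Arc : ℕ → Set
Arc k = Fin 3 × R k × R k

-- A spanning subgraph of C→_(4^k:3) is given by its arc set (a predicate on arcs).
Subgraph : ℕ → Set₁
Subgraph k = Arc k → Set

T : (k : ℕ) → R k → Subgraph k
T k α (i , u , v) = v ≡ f k α u

H : (k : ℕ) → R k → R k → Subgraph k
H k α β (f0 , u , v) = v ≡ f k α u
H k α β (fs f0 , u , v) = v ≡ f k α u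
H k α β (fs (fs f0) , u , v) = v ≡ f k β u

-- A family of spanning subgraphs indexed by R decomposes C→_(4^k:3)
-- (C = ⊕_α F α, an arc-disjoint union): every arc of C lies in exactly one F α.
IsDecomposition : (k : ℕ) → (R k → Subgraph k) → Set
IsDecomposition k F = (e : Arc k) → ∃! _≡_ (λ α → F α e)

module Submission where

-- Every arc of C→_(4^k:3) has the form y → v with y ∈ G_i, v ∈ G_{i+1}, and it
-- lies in the factor T(α) (or H(α,β)) exactly when v = x·y + α for the label α
-- used on G_i.  Since R is an additive group, the equation v = x·y + α has the
-- unique solution α = v − x·y, which gives both decompositions:
--   * In Z_{2^k} we define subtraction and show it inverts addition (both ways);
--     componentwise this makes translation w + _ a bijection of R.
--   * A bijection t with inverse s has, for every v, the unique preimage s v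
--     (uniqueSolution); hence every arc determines a unique α (f-unique).
--   * Reindexing a uniquely solvable predicate along a bijection φ keeps it
--     uniquely solvable (∃!-reindex); this handles the arcs out of G_2 in H,
--     whose label is φ(α) rather than α.

open import Defs
open import Data.Nat using (ℕ; _≥_; _+_; _∸_; _%_; _<_; NonZero)
open import Data.Nat.Properties using (+-assoc; +-comm; m+[n∸m]≡n; m∸n+n≡m; <⇒≤)
open import Data.Nat.DivMod using (%-distribˡ-+; m%n%n≡m%n; [m+n]%n≡m%n; m<n⇒m%n≡m)
open import Data.Fin using (toℕ) renaming (zero to f0; suc to fs)
open import Data.Fin.Properties using (toℕ-injective; toℕ-fromℕ<; toℕ<n)
open import Data.Product using (_×_; _,_; ∃!)
open import Function.Bundles using (_↔_; Inverse)
open import Relation.Binary.PropositionalEquality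

uniqueSolution : ∀ {a} {A : Set a} (t s : A → A) →
  (∀ v → t (s v) ≡ v) → (∀ a → s (t a) ≡ a) →
  ∀ v → ∃! _≡_ (λ a → v ≡ t a)
uniqueSolution t s ts st v =
  s v , sym (ts v) , λ { {a} refl → st a }

∃!-reindex : ∀ {a b p} {A : Set a} {B : Set b} (φ : A ↔ B) {P : B → Set p} →
  ∃! _≡_ P → ∃! _≡_ (λ α → P (Inverse.to φ α))
∃!-reindex φ {P} (β , Pβ , β-unique) =
    from β
  , subst P (sym (strictlyInverseˡ β)) Pβ
  , λ {α} Pα → trans (cong from (β-unique Pα)) (strictlyInverseʳ α)
  where open Inverse φ

module _ (k : ℕ) where
  private
    m : ℕ
    m = mod k

    instance
      m-nonZero : NonZero m
      m-nonZero = mod-nonZero k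

  toℕ-reduce : ∀ n → toℕ (reduce k n) ≡ n % m
  toℕ-reduce n = toℕ-fromℕ< _

  [a+b%m]%m≡[a+b]%m : ∀ a b → (a + b % m) % m ≡ (a + b) % m
  [a+b%m]%m≡[a+b]%m a b = begin
    (a + b % m) % m            ≡⟨ %-distribˡ-+ a (b % m) m ⟩
    (a % m + b % m % m) % m    ≡⟨ cong (λ z → (a % m + z) % m) (m%n%n≡m%n b m) ⟩
    (a % m + b % m) % m        ≡⟨ %-distribˡ-+ a b m ⟨
    (a + b) % m                ∎
    where open ≡-Reasoning

  wrap-around : ∀ a b c → c < m → a + b ≡ m + c → (a + b % m) % m ≡ c
  wrap-around a b c c<m a+b≡m+c = begin
    (a + b % m) % m   ≡⟨ [a+b%m]%m≡[a+b]%m a b ⟩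
    (a + b) % m       ≡⟨ cong (_% m) (trans a+b≡m+c (+-comm m c)) ⟩
    (c + m) % m       ≡⟨ [m+n]%n≡m%n c m ⟩
    c % m             ≡⟨ m<n⇒m%n≡m c<m ⟩
    c                 ∎
    where open ≡-Reasoning

  zsub : Zk k → Zk k → Zk k
  zsub w v = reduce k ((m ∸ toℕ w) + toℕ v)

  zadd-zsub : ∀ w v → zadd k w (zsub w v) ≡ v
  zadd-zsub w v = toℕ-injective (begin
    toℕ (zadd k w (zsub w v))                    ≡⟨ toℕ-reduce _ ⟩
    (toℕ w + toℕ (zsub w v)) % m                 ≡⟨ cong (λ z → (toℕ w + z) % m) (toℕ-reduce _) ⟩
    (toℕ w + ((m ∸ toℕ w) + toℕ v) % m) % m      ≡⟨ wrap-around _ _ _ (toℕ<n v) sums ⟩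
    toℕ v                                        ∎)
    where
    open ≡-Reasoning
    sums : toℕ w + ((m ∸ toℕ w) + toℕ v) ≡ m + toℕ v
    sums = trans (sym (+-assoc (toℕ w) _ _))
                 (cong (_+ toℕ v) (m+[n∸m]≡n (<⇒≤ (toℕ<n w))))

  zsub-zadd : ∀ w a → zsub w (zadd k w a) ≡ a
  zsub-zadd w a = toℕ-injective (begin
    toℕ (zsub w (zadd k w a))                    ≡⟨ toℕ-reduce _ ⟩
    ((m ∸ toℕ w) + toℕ (zadd k w a)) % m         ≡⟨ cong (λ z → ((m ∸ toℕ w) + z) % m) (toℕ-reduce _) ⟩
    ((m ∸ toℕ w) + (toℕ w + toℕ a) % m) % m      ≡⟨ wrap-around _ _ _ (toℕ<n a) sums ⟩
    toℕ a                                        ∎)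
    where
    open ≡-Reasoning
    sums : (m ∸ toℕ w) + (toℕ w + toℕ a) ≡ m + toℕ a
    sums = trans (sym (+-assoc (m ∸ toℕ w) _ _))
                 (cong (_+ toℕ a) (m∸n+n≡m (<⇒≤ (toℕ<n w))))

  rsub : R k → R k → R k
  rsub (w₁ , w₂) (v₁ , v₂) = zsub w₁ v₁ , zsub w₂ v₂

  radd-rsub : ∀ w v → radd k w (rsub w v) ≡ v
  radd-rsub (w₁ , w₂) (v₁ , v₂) = cong₂ _,_ (zadd-zsub w₁ v₁) (zadd-zsub w₂ v₂)

  rsub-radd : ∀ w a → rsub w (radd k w a) ≡ a
  rsub-radd (w₁ , w₂) (a₁ , a₂) = cong₂ _,_ (zsub-zadd w₁ a₁) (zsub-zadd w₂ a₂)

  f-unique : ∀ y v → ∃! _≡_ (λ α → v ≡ f k α y)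
  f-unique y v =
    uniqueSolution (radd k (rmul k (xR k) y)) (rsub (rmul k (xR k) y))
                   (radd-rsub _) (rsub-radd _) v

lemma3p2 : (k : ℕ) → k ≥ 1 → (φ : R k ↔ R k) →
    IsDecomposition k (T k) ×
    IsDecomposition k (λ α → H k α (Inverse.to φ α))
lemma3p2 k _ φ = T-decomposition , H-decomposition
  where
  T-decomposition : IsDecomposition k (T k)
  T-decomposition (_ , y , v) = f-unique k y v

  -- Out of G_0 and G_1 the label of H(α, φ α) is α; out of G_2 it is φ α.
  H-decomposition : IsDecomposition k (λ α → H k α (Inverse.to φ α))
  H-decomposition (f0 , y , v)           = f-unique k y v
  H-decomposition (fs f0 , y , v)        = f-unique k y v
  H-decomposition (fs (fs f0) , y , v)   = ∃!-reindex φ (f-unique k y v)
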